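{- Let $\mathsf{C}$ be an adhesively cocomplete category. The topology on $\mathsf{C}_{mono}$ given by $\mathcal{S}ubmon$ (restricted to $\mathsf{C}_{mono}$) is subordinate to the subobject topology on $\mathsf{C}_{mono}$.
   Context: A category is adhesive if it has pushouts along monomorphisms, has pullbacks, and pushouts along monomorphisms are van Kampen; it is adhesively cocomplete if moreover every submonic diagram (monomorphism-preserving functor from a finite category all of whose arrows are monic) has a colimit. $\mathsf{C}_{mono}$ is the subcategory of $\mathsf{C}$ with the same objects and only the monomorphisms. $\mathcal{S}ubmon(c)$ consists of the colimit cocones of submonic diagrams with colimit $c$ together with singleton families $\{f\}$, $f\colon a\to c$ an isomorphism. The subobject topology takes as coverings of an object $c$ the families of (equivalence classes of) monomorphisms into $c$ whose union is $c$. A family $\mathcal{V}=\{V_j\to U\}$ is a refinement of $\mathcal{U}=\{U_i\to U\}$ if each $V_j\to U$ factors through some $U_i\to U$. A topology $J$ is subordinate to $J'$ if every covering in $J$ has a refinement that is a covering in $J'$. -}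

module Defs where

open import Level using (Level; _⊔_; suc; 0ℓ)
open import Data.Nat using (ℕ)
open import Data.Fin using (Fin)
open import Data.Unit.Polymorphic using (⊤; tt)
open import Data.Product using (Σ; _×_; _,_; ∃; ∃-syntax)
open import Function using (_⇔_)
open import Relation.Binary using (IsEquivalence)
open import Relation.Binary.PropositionalEquality using (_≡_)

record Category (o ℓ e : Level) : Set (suc (o ⊔ ℓ ⊔ e)) where
  infix  4 _≈_
  infixr 9 _∘_
  field
    Obj   : Set o
    _⇒_   : Obj → Obj → Set ℓ
    _≈_   : ∀ {A B} → A ⇒ B → A ⇒ B → Set e
    id    : ∀ {A} → A ⇒ A
    _∘_   : ∀ {A B C} → B ⇒ C → A ⇒ B → A ⇒ C
    equiv : ∀ {A B} → IsEquivalence (_≈_ {A} {B})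
    ∘-resp-≈ : ∀ {A B C} {f h : B ⇒ C} {g i : A ⇒ B} → f ≈ h → g ≈ i → f ∘ g ≈ h ∘ i
    assoc : ∀ {A B C D} {f : A ⇒ B} {g : B ⇒ C} {h : C ⇒ D} → (h ∘ g) ∘ f ≈ h ∘ (g ∘ f)
    identityˡ : ∀ {A B} {f : A ⇒ B} → id ∘ f ≈ f
    identityʳ : ∀ {A B} {f : A ⇒ B} → f ∘ id ≈ f

module _ {o ℓ e} (C : Category o ℓ e) where
  open Category C

  Mono : ∀ {A B} → A ⇒ B → Set (o ⊔ ℓ ⊔ e)
  Mono {A} f = ∀ {X} (g h : X ⇒ A) → f ∘ g ≈ f ∘ h → g ≈ h

  IsIso : ∀ {A B} → A ⇒ B → Set (ℓ ⊔ e)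
  IsIso {A} {B} f = Σ (B ⇒ A) λ g → (g ∘ f ≈ id) × (f ∘ g ≈ id)

  IsPullback : ∀ {P X Y Z} (p₁ : P ⇒ X) (p₂ : P ⇒ Y) (f : X ⇒ Z) (g : Y ⇒ Z) → Set (o ⊔ ℓ ⊔ e)
  IsPullback {P} {X} {Y} p₁ p₂ f g =
    (f ∘ p₁ ≈ g ∘ p₂) ×
    (∀ {Q} (q₁ : Q ⇒ X) (q₂ : Q ⇒ Y) → f ∘ q₁ ≈ g ∘ q₂ →
      Σ (Q ⇒ P) λ u → (p₁ ∘ u ≈ q₁) × (p₂ ∘ u ≈ q₂) ×
        (∀ (v : Q ⇒ P) → p₁ ∘ v ≈ q₁ → p₂ ∘ v ≈ q₂ → v ≈ u))

  IsPushout : ∀ {A B C D} (f : A ⇒ B) (g : A ⇒ C) (i₁ : B ⇒ D) (i₂ : C ⇒ D) → Set (o ⊔ ℓ ⊔ e)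
  IsPushout {A} {B} {C'} {D} f g i₁ i₂ =
    (i₁ ∘ f ≈ i₂ ∘ g) ×
    (∀ {Q} (q₁ : B ⇒ Q) (q₂ : C' ⇒ Q) → q₁ ∘ f ≈ q₂ ∘ g →
      Σ (D ⇒ Q) λ u → (u ∘ i₁ ≈ q₁) × (u ∘ i₂ ≈ q₂) ×
        (∀ (v : D ⇒ Q) → v ∘ i₁ ≈ q₁ → v ∘ i₂ ≈ q₂ → v ≈ u))

  HasPullbacks : Set (o ⊔ ℓ ⊔ e)
  HasPullbacks = ∀ {X Y Z} (f : X ⇒ Z) (g : Y ⇒ Z) →
    Σ Obj λ P → Σ (P ⇒ X) λ p₁ → Σ (P ⇒ Y) λ p₂ → IsPullback p₁ p₂ f g

  HasPushoutsAlongMonos : Set (o ⊔ ℓ ⊔ e)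
  HasPushoutsAlongMonos = ∀ {A B C'} (m : A ⇒ B) (f : A ⇒ C') → Mono m →
    Σ Obj λ D → Σ (B ⇒ D) λ i₁ → Σ (C' ⇒ D) λ i₂ → IsPushout m f i₁ i₂

  -- Van Kampen property of a pushout square (bottom face of a cube)
  --   A --m--> B ,  A --f--> C ,  B --n--> D ,  C --g--> D.
  -- For every commutative cube over it (top face A' B' C' D' with maps
  -- m' f' n' g', vertical maps a b c d) whose back faces are pullbacks,
  -- the top face is a pushout iff the front faces are pullbacks.
  IsVanKampen : ∀ {A B C' D} (m : A ⇒ B) (f : A ⇒ C') (n : B ⇒ D) (g : C' ⇒ D) → Set (o ⊔ ℓ ⊔ e)
  IsVanKampen {A} {B} {C'} {D} m f n g =
    ∀ {A' B' C'' D'} (m' : A' ⇒ B') (f' : A' ⇒ C'') (n' : B' ⇒ D') (g' : C'' ⇒ D')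
      (a : A' ⇒ A) (b : B' ⇒ B) (c : C'' ⇒ C') (d : D' ⇒ D) →
      n' ∘ m' ≈ g' ∘ f' →
      d ∘ n' ≈ n ∘ b →
      d ∘ g' ≈ g ∘ c →
      IsPullback m' a b m →
      IsPullback f' a c f →
      (IsPushout m' f' n' g' ⇔ (IsPullback n' b d n × IsPullback g' c d g))

  record IsAdhesive : Set (o ⊔ ℓ ⊔ e) where
    field
      pullbacks : HasPullbacks
      pushoutsAlongMonos : HasPushoutsAlongMonos
      vanKampen : ∀ {A B C' D} (m : A ⇒ B) (f : A ⇒ C') (n : B ⇒ D) (g : C' ⇒ D) →
        Mono m → IsPushout m f n g → IsVanKampen m f n g

record Functor {o ℓ e o' ℓ' e'} (J : Category o ℓ e) (C : Category o' ℓ' e')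
       : Set (o ⊔ ℓ ⊔ e ⊔ o' ⊔ ℓ' ⊔ e') where
  private
    module J = Category J
    module C = Category C
  field
    F₀ : J.Obj → C.Obj
    F₁ : ∀ {A B} → A J.⇒ B → F₀ A C.⇒ F₀ B
    identity : ∀ {A} → F₁ (J.id {A}) C.≈ C.id
    homomorphism : ∀ {A B X} {f : A J.⇒ B} {g : B J.⇒ X} → F₁ (g J.∘ f) C.≈ F₁ g C.∘ F₁ f
    F-resp-≈ : ∀ {A B} {f g : A J.⇒ B} → f J.≈ g → F₁ f C.≈ F₁ g

IsFiniteCategory : ∀ {o ℓ e} → Category o ℓ e → Set (o ⊔ ℓ ⊔ e)
IsFiniteCategory J =
  (Σ ℕ λ n → Σ (Fin n → Obj) λ enum → ∀ A → Σ (Fin n) λ i → enum i ≡ A) ×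
  (∀ A B → Σ ℕ λ k → Σ (Fin k → A ⇒ B) λ enum → ∀ f → Σ (Fin k) λ i → enum i ≈ f)
  where open Category J

record SubmonicDiagram {o ℓ e} (C : Category o ℓ e) : Set (suc 0ℓ ⊔ o ⊔ ℓ ⊔ e) where
  field
    Shape      : Category 0ℓ 0ℓ 0ℓ
    finite     : IsFiniteCategory Shape
    allMono    : ∀ {A B} (f : Category._⇒_ Shape A B) → Mono Shape f
    D          : Functor Shape C
    preserves  : ∀ {A B} (f : Category._⇒_ Shape A B) → Mono Shape f → Mono C (Functor.F₁ D f)

module _ {o ℓ e} (C : Category o ℓ e) where
  open Category C

  record Cocone (Δ : SubmonicDiagram C) (x : Obj) : Set (o ⊔ ℓ ⊔ e) where
    open SubmonicDiagram Δ
    private module J = Category Shape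
    open Functor D
    field
      leg : ∀ j → F₀ j ⇒ x
      commute : ∀ {i j} (f : i J.⇒ j) → leg j ∘ F₁ f ≈ leg i

  IsColimit : ∀ (Δ : SubmonicDiagram C) {c} → Cocone Δ c → Set (o ⊔ ℓ ⊔ e)
  IsColimit Δ {c} λc = ∀ {x} (μ : Cocone Δ x) →
    Σ (c ⇒ x) λ u → (∀ j → u ∘ Cocone.leg λc j ≈ Cocone.leg μ j) ×
      (∀ (v : c ⇒ x) → (∀ j → v ∘ Cocone.leg λc j ≈ Cocone.leg μ j) → v ≈ u)

  record IsAdhesivelyCocomplete : Set (suc 0ℓ ⊔ o ⊔ ℓ ⊔ e) where
    field
      adhesive : IsAdhesive C
      submonicColimits : ∀ (Δ : SubmonicDiagram C) →
        Σ Obj λ c → Σ (Cocone Δ c) λ λc → IsColimit Δ λc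

  record Family (c : Obj) : Set (suc 0ℓ ⊔ o ⊔ ℓ) where
    constructor family
    field
      Idx : Set
      dom : Idx → Obj
      arr : ∀ i → dom i ⇒ c

  data Submon (c : Obj) : Family c → Set (suc 0ℓ ⊔ o ⊔ ℓ ⊔ e) where
    colimitCocone : (Δ : SubmonicDiagram C) (λc : Cocone Δ c) → IsColimit Δ λc →
      Submon c (family (Category.Obj (SubmonicDiagram.Shape Δ))
                       (Functor.F₀ (SubmonicDiagram.D Δ)) (Cocone.leg λc))
    isoSingleton : ∀ {a} (f : a ⇒ c) → IsIso C f →
      Submon c (family (⊤ {0ℓ}) (λ _ → a) (λ _ → f))

  AllMono : ∀ {c} → Family c → Set (o ⊔ ℓ ⊔ e)
  AllMono F = ∀ i → Mono C (Family.arr F i)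

  -- the union of a family of subobjects of c is (all of) c: every subobject
  -- m : s ↣ c containing every member of the family is the top subobject.
  UnionIsWhole : ∀ {c} → Family c → Set (o ⊔ ℓ ⊔ e)
  UnionIsWhole {c} F = ∀ {s} (m : s ⇒ c) → Mono C m →
    (∀ i → Σ (Family.dom F i ⇒ s) λ h → m ∘ h ≈ Family.arr F i) → IsIso C m

  SubobjectCovering : ∀ {c} → Family c → Set (o ⊔ ℓ ⊔ e)
  SubobjectCovering F = AllMono F × UnionIsWhole F

  Refines : ∀ {c} → Family c → Family c → Set (o ⊔ ℓ ⊔ e)
  Refines V U = ∀ j → Σ (Family.Idx U) λ i →
    Σ (Family.dom V j ⇒ Family.dom U i) λ h →
      Mono C h × (Family.arr U i ∘ h ≈ Family.arr V j)

  SubmonSubordinateToSubobject : Set (suc 0ℓ ⊔ o ⊔ ℓ ⊔ e)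
  SubmonSubordinateToSubobject = ∀ (c : Obj) (U : Family c) →
    Submon c U → AllMono U →
    Σ (Family c) λ V → SubobjectCovering V × Refines V U

{-# OPTIONS --safe #-}
-- A member of Submon(c) is already a covering in the subobject topology, so
-- it refines itself.  Its union is all of c because its legs are jointly
-- epimorphic: a subobject m : s ↣ c through which every leg factors receives
-- the induced cocone, and the mediating map u : c → s satisfies m ∘ u ≈ id by
-- uniqueness of maps out of the colimit (for an iso singleton, u is the
-- factorisation composed with the inverse).  A mono with a right inverse is
-- an iso.
module Submission where

open import Level using (_⊔_)
open import Defs
open import Data.Product using (Σ; _,_; proj₁; proj₂)
open import Relation.Binary using (Setoid; IsEquivalence)
import Relation.Binary.Reasoning.Setoid as SetoidReasoning

module _ {o ℓ e} (C : Category o ℓ e) where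
  open Category C

  hom-setoid : Obj → Obj → Setoid ℓ e
  hom-setoid A B = record { Carrier = A ⇒ B ; _≈_ = _≈_ ; isEquivalence = equiv }

  module HomReasoning {A B : Obj} = SetoidReasoning (hom-setoid A B)
  module ≈ {A B : Obj} = IsEquivalence (equiv {A} {B})

  pullˡ : ∀ {A B D E} {f : D ⇒ E} {g : B ⇒ D} {h : A ⇒ B} {k : B ⇒ E} →
    f ∘ g ≈ k → f ∘ (g ∘ h) ≈ k ∘ h
  pullˡ p = ≈.trans (≈.sym assoc) (∘-resp-≈ p ≈.refl)

  id-mono : ∀ {A} → Mono C (id {A})
  id-mono g h p = ≈.trans (≈.sym identityˡ) (≈.trans p identityˡ)

  mono∧rightInverse⇒iso : ∀ {s c} (m : s ⇒ c) (u : c ⇒ s) →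
    Mono C m → m ∘ u ≈ id → IsIso C m
  mono∧rightInverse⇒iso m u m-mono m∘u≈id = u , m-mono (u ∘ m) id m∘[u∘m]≈m∘id , m∘u≈id
    where
    open HomReasoning
    m∘[u∘m]≈m∘id : m ∘ (u ∘ m) ≈ m ∘ id
    m∘[u∘m]≈m∘id = begin
      m ∘ (u ∘ m) ≈⟨ pullˡ m∘u≈id ⟩
      id ∘ m      ≈⟨ identityˡ ⟩
      m           ≈⟨ identityʳ ⟨
      m ∘ id      ∎

  Refines-refl : ∀ {c} (U : Family C c) → Refines C U U
  Refines-refl U i = i , id , id-mono , identityʳ

  FactorsThrough : ∀ {c s} → Family C c → s ⇒ c → Set (ℓ ⊔ e)
  FactorsThrough {s = s} U m = ∀ i → Σ (Family.dom U i ⇒ s) λ h → m ∘ h ≈ Family.arr U i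

  module _ (Δ : SubmonicDiagram C) {c : Obj} (λc : Cocone C Δ c) where
    open SubmonicDiagram Δ
    open Functor D
    open Cocone λc

    legs : Family C c
    legs = family (Category.Obj Shape) F₀ leg

    factorCocone : ∀ {s} (m : s ⇒ c) → Mono C m → FactorsThrough legs m → Cocone C Δ s
    factorCocone m m-mono fac = record
      { leg = λ j → proj₁ (fac j)
      ; commute = λ {i} {j} f → m-mono _ _ (begin
          m ∘ (proj₁ (fac j) ∘ F₁ f) ≈⟨ pullˡ (proj₂ (fac j)) ⟩
          leg j ∘ F₁ f               ≈⟨ commute f ⟩
          leg i                      ≈⟨ proj₂ (fac i) ⟨
          m ∘ proj₁ (fac i)          ∎)
      }
      where open HomReasoning

    colimit-endo≈id : IsColimit C Δ λc →
      ∀ (v : c ⇒ c) → (∀ j → v ∘ leg j ≈ leg j) → v ≈ id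
    colimit-endo≈id colim v v-fixes = ≈.trans (unique v v-fixes) (≈.sym (unique id λ _ → identityˡ))
      where unique = proj₂ (proj₂ (colim λc))

    colimit-unionIsWhole : IsColimit C Δ λc → UnionIsWhole C legs
    colimit-unionIsWhole colim m m-mono fac =
      mono∧rightInverse⇒iso m u m-mono (colimit-endo≈id colim (m ∘ u) m∘u-fixes)
      where
      μ = factorCocone m m-mono fac
      u = proj₁ (colim μ)
      m∘u-fixes : ∀ j → (m ∘ u) ∘ leg j ≈ leg j
      m∘u-fixes j = begin
        (m ∘ u) ∘ leg j    ≈⟨ assoc ⟩
        m ∘ (u ∘ leg j)    ≈⟨ ∘-resp-≈ ≈.refl (proj₁ (proj₂ (colim μ)) j) ⟩
        m ∘ proj₁ (fac j)  ≈⟨ proj₂ (fac j) ⟩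
        leg j              ∎
        where open HomReasoning

  mono-factoring-iso⇒iso : ∀ {a s c} (m : s ⇒ c) (h : a ⇒ s) (f : a ⇒ c) →
    Mono C m → m ∘ h ≈ f → IsIso C f → IsIso C m
  mono-factoring-iso⇒iso m h f m-mono m∘h≈f (f⁻¹ , _ , f∘f⁻¹≈id) =
    mono∧rightInverse⇒iso m (h ∘ f⁻¹) m-mono (≈.trans (pullˡ m∘h≈f) f∘f⁻¹≈id)

  submon-unionIsWhole : ∀ {c} {U : Family C c} → Submon C c U → UnionIsWhole C U
  submon-unionIsWhole (colimitCocone Δ λc colim) = colimit-unionIsWhole Δ λc colim
  submon-unionIsWhole (isoSingleton f f-iso) m m-mono fac =
    mono-factoring-iso⇒iso m (proj₁ (fac _)) f m-mono (proj₂ (fac _)) f-iso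

mainTheorem3 : ∀ {o ℓ e} (C : Category o ℓ e) → IsAdhesivelyCocomplete C →
    SubmonSubordinateToSubobject C
mainTheorem3 C _ c U U-submon U-mono =
  U , (U-mono , submon-unionIsWhole C U-submon) , Refines-refl C U
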